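{- Intuitionistic propositional logic $\mathsf{IPC}$ has both the propositional disjunctive interpolation property $\mathrm{PDIP}$ and its monotone version $\mathrm{mPDIP}$.
   Context: Formulas are over $\{\top,\bot,\wedge,\vee,\to\}$; $V(\phi)$ is the set of atoms of $\phi$; a formula is monotone if it contains no implication (negation $\neg\phi$ abbreviates $\phi\to\bot$). For a superintuitionistic logic $L$, an $L$-propositional disjunctive interpolant ($L$-PDI) for $(\phi\to\psi\vee\theta)\in L$ is a pair $(I,J)$ of formulas with $V(I),V(J)\subseteq V(\phi)$ such that $\phi\to(I\vee J)$, $I\to\psi$ and $J\to\theta$ are in $L$. An $L$-mPDI is an $L$-PDI where additionally $\phi$, $I$, $J$ are monotone. $L$ has PDIP if every $(\phi\to\psi\vee\theta)\in L$ has an $L$-PDI, and has mPDIP if every $(\phi\to\psi\vee\theta)\in L$ with $\phi$ monotone has an $L$-mPDI. -}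

module Defs where

open import Data.Nat using (ℕ)
open import Data.List using (List; []; _∷_)
open import Data.List.Membership.Propositional using (_∈_)
open import Data.Product using (Σ; _×_)

infixr 6 _∧_
infixr 5 _∨_
infixr 4 _⇒_

data Formula : Set where
  atom : ℕ → Formula
  ⊤′   : Formula
  ⊥′   : Formula
  _∧_  : Formula → Formula → Formula
  _∨_  : Formula → Formula → Formula
  _⇒_  : Formula → Formula → Formula

¬′_ : Formula → Formula
¬′ φ = φ ⇒ ⊥′

data _∈V_ (p : ℕ) : Formula → Set where
  here  : p ∈V atom p
  ∧ˡ : ∀ {φ ψ} → p ∈V φ → p ∈V (φ ∧ ψ)
  ∧ʳ : ∀ {φ ψ} → p ∈V ψ → p ∈V (φ ∧ ψ)
  ∨ˡ : ∀ {φ ψ} → p ∈V φ → p ∈V (φ ∨ ψ)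
  ∨ʳ : ∀ {φ ψ} → p ∈V ψ → p ∈V (φ ∨ ψ)
  ⇒ˡ : ∀ {φ ψ} → p ∈V φ → p ∈V (φ ⇒ ψ)
  ⇒ʳ : ∀ {φ ψ} → p ∈V ψ → p ∈V (φ ⇒ ψ)

_⊆V_ : Formula → Formula → Set
φ ⊆V ψ = ∀ {p} → p ∈V φ → p ∈V ψ

data Monotone : Formula → Set where
  atom : ∀ p → Monotone (atom p)
  ⊤′   : Monotone ⊤′
  ⊥′   : Monotone ⊥′
  _∧_  : ∀ {φ ψ} → Monotone φ → Monotone ψ → Monotone (φ ∧ ψ)
  _∨_  : ∀ {φ ψ} → Monotone φ → Monotone ψ → Monotone (φ ∨ ψ)

infix 2 _⊢_
data _⊢_ (Γ : List Formula) : Formula → Set where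
  ax    : ∀ {φ} → φ ∈ Γ → Γ ⊢ φ
  ⊤I    : Γ ⊢ ⊤′
  ⊥E    : ∀ {φ} → Γ ⊢ ⊥′ → Γ ⊢ φ
  ∧I    : ∀ {φ ψ} → Γ ⊢ φ → Γ ⊢ ψ → Γ ⊢ φ ∧ ψ
  ∧E₁   : ∀ {φ ψ} → Γ ⊢ φ ∧ ψ → Γ ⊢ φ
  ∧E₂   : ∀ {φ ψ} → Γ ⊢ φ ∧ ψ → Γ ⊢ ψ
  ∨I₁   : ∀ {φ ψ} → Γ ⊢ φ → Γ ⊢ φ ∨ ψ
  ∨I₂   : ∀ {φ ψ} → Γ ⊢ ψ → Γ ⊢ φ ∨ ψ
  ∨E    : ∀ {φ ψ χ} → Γ ⊢ φ ∨ ψ → (φ ∷ Γ) ⊢ χ → (ψ ∷ Γ) ⊢ χ → Γ ⊢ χ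
  ⇒I    : ∀ {φ ψ} → (φ ∷ Γ) ⊢ ψ → Γ ⊢ φ ⇒ ψ
  ⇒E    : ∀ {φ ψ} → Γ ⊢ φ ⇒ ψ → Γ ⊢ φ → Γ ⊢ ψ

IPC : Formula → Set
IPC φ = [] ⊢ φ

IsPDI : Formula → Formula → Formula → Formula → Formula → Set
IsPDI φ ψ θ I J =
  (I ⊆V φ) × (J ⊆V φ) × IPC (φ ⇒ I ∨ J) × IPC (I ⇒ ψ) × IPC (J ⇒ θ)

HasPDIP : Set
HasPDIP = ∀ φ ψ θ → IPC (φ ⇒ ψ ∨ θ) →
  Σ Formula λ I → Σ Formula λ J → IsPDI φ ψ θ I J

HasmPDIP : Set
HasmPDIP = ∀ φ ψ θ → Monotone φ → IPC (φ ⇒ ψ ∨ θ) →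
  Σ Formula λ I → Σ Formula λ J → Monotone I × Monotone J × IsPDI φ ψ θ I J

{-# OPTIONS --safe #-}
module Submission where

-- A Kripke-style model whose worlds are the formulas of a class W, ordered by
-- provable implication: w forces A ∨ B when w ⊢ I ∨ J for some I, J ∈ W with
-- I forcing A and J forcing B, and forcing at atoms, ⊥ and implications also
-- demands provability. Then forcing implies provability, every formula of W
-- forces itself, and natural deduction is sound; for ∨-elimination, W must be
-- closed under ∧ and ∨ so that a world w with w ⊢ X ∨ Y can be glued from
-- w ∧ X and w ∧ Y. So if φ ∈ W and ⊢ φ → ψ ∨ θ, then φ forces ψ ∨ θ, which
-- unfolds to interpolants I, J ∈ W. Taking for W the formulas with atoms in
-- V(φ) gives PDIP; the monotone ones among them give mPDIP.

open import Defs
open import Data.Product using (_×_; Σ; _,_; proj₁; proj₂)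
open import Data.Unit using (tt) renaming (⊤ to Unit)
open import Data.List using (List; []; _∷_)
open import Data.List.Relation.Unary.Any using (here; there)
open import Data.List.Relation.Unary.All as All using (All; []; _∷_)
open import Data.List.Membership.Propositional using (_∈_)
open import Data.List.Relation.Binary.Subset.Propositional using (_⊆_)
open import Data.List.Relation.Binary.Subset.Propositional.Properties using (∷⁺ʳ)
open import Relation.Binary.PropositionalEquality using (refl)
open import Relation.Unary using (_∩_)
open import Function using (id)

rename : ∀ {Γ Δ A} → Γ ⊆ Δ → Γ ⊢ A → Δ ⊢ A
rename ρ (ax i)     = ax (ρ i)
rename ρ ⊤I         = ⊤I
rename ρ (⊥E d)     = ⊥E (rename ρ d)
rename ρ (∧I d e)   = ∧I (rename ρ d) (rename ρ e)
rename ρ (∧E₁ d)    = ∧E₁ (rename ρ d)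
rename ρ (∧E₂ d)    = ∧E₂ (rename ρ d)
rename ρ (∨I₁ d)    = ∨I₁ (rename ρ d)
rename ρ (∨I₂ d)    = ∨I₂ (rename ρ d)
rename ρ (∨E d e f) = ∨E (rename ρ d) (rename (∷⁺ʳ _ ρ) e) (rename (∷⁺ʳ _ ρ) f)
rename ρ (⇒I d)     = ⇒I (rename (∷⁺ʳ _ ρ) d)
rename ρ (⇒E d e)   = ⇒E (rename ρ d) (rename ρ e)

Substitution : List Formula → List Formula → Set
Substitution Γ Δ = ∀ {A} → A ∈ Γ → Δ ⊢ A

extend : ∀ {Γ Δ C} → Substitution Γ Δ → Substitution (C ∷ Γ) (C ∷ Δ)
extend σ (here eq) = ax (here eq)
extend σ (there i) = rename there (σ i)

substitute : ∀ {Γ Δ A} → Substitution Γ Δ → Γ ⊢ A → Δ ⊢ A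
substitute σ (ax i)     = σ i
substitute σ ⊤I         = ⊤I
substitute σ (⊥E d)     = ⊥E (substitute σ d)
substitute σ (∧I d e)   = ∧I (substitute σ d) (substitute σ e)
substitute σ (∧E₁ d)    = ∧E₁ (substitute σ d)
substitute σ (∧E₂ d)    = ∧E₂ (substitute σ d)
substitute σ (∨I₁ d)    = ∨I₁ (substitute σ d)
substitute σ (∨I₂ d)    = ∨I₂ (substitute σ d)
substitute σ (∨E d e f) = ∨E (substitute σ d) (substitute (extend σ) e) (substitute (extend σ) f)
substitute σ (⇒I d)     = ⇒I (substitute (extend σ) d)
substitute σ (⇒E d e)   = ⇒E (substitute σ d) (substitute σ e)

infix 2 _⊢₁_
_⊢₁_ : Formula → Formula → Set
A ⊢₁ B = A ∷ [] ⊢ B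

hyp : ∀ {A} → A ⊢₁ A
hyp = ax (here refl)

⊢₁-weaken : ∀ {Γ A B} → A ⊢₁ B → A ∷ Γ ⊢ B
⊢₁-weaken = rename (∷⁺ʳ _ λ ())

⊢₁-trans : ∀ {A B C} → A ⊢₁ B → B ⊢₁ C → A ⊢₁ C
⊢₁-trans d = substitute λ { (here refl) → d }

∧-monoˡ : ∀ {A B C} → A ⊢₁ B → A ∧ C ⊢₁ B ∧ C
∧-monoˡ d = ∧I (⊢₁-trans (∧E₁ hyp) d) (∧E₂ hyp)

∨-map : ∀ {A B C B′ C′} → A ⊢₁ B ∨ C → B ⊢₁ B′ → C ⊢₁ C′ → A ⊢₁ B′ ∨ C′
∨-map d e f = ∨E d (∨I₁ (⊢₁-weaken e)) (∨I₂ (⊢₁-weaken f))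

∨-cases : ∀ {A B C D} → A ⊢₁ B ∨ C → A ∧ B ⊢₁ D → A ∧ C ⊢₁ D → A ⊢₁ D
∨-cases d e f = ∨E d (substitute pair e) (substitute pair f)
  where
  pair : ∀ {A B} → Substitution (A ∧ B ∷ []) (B ∷ A ∷ [])
  pair (here refl) = ∧I (ax (there (here refl))) (ax (here refl))

record InterpolantClass (W : Formula → Set) : Set where
  field
    ⊥-closed    : W ⊥′
    ∧-closed    : ∀ {X Y} → W X → W Y → W (X ∧ Y)
    ∨-closed    : ∀ {X Y} → W X → W Y → W (X ∨ Y)
    ∧-inversion : ∀ {X Y} → W (X ∧ Y) → W X × W Y
    ∨-inversion : ∀ {X Y} → W (X ∨ Y) → W X × W Y
    ⇒-inversion : ∀ {X Y} → W (X ⇒ Y) → W Y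

module Forcing {W : Formula → Set} (𝒲 : InterpolantClass W) where
  open InterpolantClass 𝒲

  record Split (w : Formula) (P Q : Formula → Set) : Set where
    constructor split
    field
      left right   : Formula
      left∈W       : W left
      right∈W      : W right
      covers       : w ⊢₁ left ∨ right
      left-forces  : P left
      right-forces : Q right

  infix 3 _⊩_
  _⊩_ : Formula → Formula → Set
  w ⊩ atom p = w ⊢₁ atom p
  w ⊩ ⊤′     = Unit
  w ⊩ ⊥′     = w ⊢₁ ⊥′
  w ⊩ A ∧ B  = (w ⊩ A) × (w ⊩ B)
  w ⊩ A ∨ B  = Split w (_⊩ A) (_⊩ B)
  w ⊩ A ⇒ B  = (w ⊢₁ A ⇒ B) × (∀ v → W v → v ⊢₁ w → v ⊩ A → v ⊩ B)

  ⊩-mono : ∀ {w v} A → v ⊢₁ w → w ⊩ A → v ⊩ A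
  ⊩-mono (atom p) v≤w s       = ⊢₁-trans v≤w s
  ⊩-mono ⊤′       v≤w s       = tt
  ⊩-mono ⊥′       v≤w s       = ⊢₁-trans v≤w s
  ⊩-mono (A ∧ B)  v≤w (s , t) = ⊩-mono A v≤w s , ⊩-mono B v≤w t
  ⊩-mono (A ∨ B)  v≤w (split I J I∈W J∈W cover s t) =
    split I J I∈W J∈W (⊢₁-trans v≤w cover) s t
  ⊩-mono (A ⇒ B)  v≤w (d , f) =
    ⊢₁-trans v≤w d , λ u u∈W u≤v → f u u∈W (⊢₁-trans u≤v v≤w)

  ⊩-⊥E : ∀ {w} A → w ⊢₁ ⊥′ → w ⊩ A
  ⊩-⊥E (atom p) d = ⊥E d
  ⊩-⊥E ⊤′       d = tt
  ⊩-⊥E ⊥′       d = d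
  ⊩-⊥E (A ∧ B)  d = ⊩-⊥E A d , ⊩-⊥E B d
  ⊩-⊥E (A ∨ B)  d = split ⊥′ ⊥′ ⊥-closed ⊥-closed (⊥E d) (⊩-⊥E A hyp) (⊩-⊥E B hyp)
  ⊩-⊥E (A ⇒ B)  d = ⊥E d , λ v _ v≤w _ → ⊩-⊥E B (⊢₁-trans v≤w d)

  reify : ∀ {w} A → w ⊩ A → w ⊢₁ A
  reify (atom p) s       = s
  reify ⊤′       s       = ⊤I
  reify ⊥′       s       = s
  reify (A ∧ B)  (s , t) = ∧I (reify A s) (reify B t)
  reify (A ∨ B)  (split I J _ _ cover s t) = ∨-map cover (reify A s) (reify B t)
  reify (A ⇒ B)  (d , _) = d

  reflect : ∀ {w} A → W A → w ⊢₁ A → w ⊩ A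
  reflect (atom p) _   d = d
  reflect ⊤′       _   d = tt
  reflect ⊥′       _   d = d
  reflect (A ∧ B)  A∧B∈W d =
    let A∈W , B∈W = ∧-inversion A∧B∈W
    in reflect A A∈W (∧E₁ d) , reflect B B∈W (∧E₂ d)
  reflect (A ∨ B)  A∨B∈W d =
    let A∈W , B∈W = ∨-inversion A∨B∈W
    in split A B A∈W B∈W d (reflect A A∈W hyp) (reflect B B∈W hyp)
  reflect (A ⇒ B)  A⇒B∈W d =
    d , λ v _ v≤w a → reflect B (⇒-inversion A⇒B∈W) (⇒E (⊢₁-trans v≤w d) (reify A a))

  ⊩-glue : ∀ {w X Y} C → W X → W Y → w ⊢₁ X ∨ Y → w ∧ X ⊩ C → w ∧ Y ⊩ C → w ⊩ C
  ⊩-glue (atom p) _ _ cover s t = ∨-cases cover s t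
  ⊩-glue ⊤′       _ _ cover s t = tt
  ⊩-glue ⊥′       _ _ cover s t = ∨-cases cover s t
  ⊩-glue (A ∧ B) X∈W Y∈W cover (s₁ , s₂) (t₁ , t₂) =
    ⊩-glue A X∈W Y∈W cover s₁ t₁ , ⊩-glue B X∈W Y∈W cover s₂ t₂
  ⊩-glue (A ∨ B) _ _ cover (split I₁ J₁ I₁∈W J₁∈W cover₁ s₁ t₁) (split I₂ J₂ I₂∈W J₂∈W cover₂ s₂ t₂) =
    -- I₁ ∨ I₂ forces A by gluing along its own trivial cover, and likewise J₁ ∨ J₂.
    split (I₁ ∨ I₂) (J₁ ∨ J₂) (∨-closed I₁∈W I₂∈W) (∨-closed J₁∈W J₂∈W)
      (∨-cases cover (∨-map cover₁ (∨I₁ hyp) (∨I₁ hyp)) (∨-map cover₂ (∨I₂ hyp) (∨I₂ hyp)))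
      (⊩-glue A I₁∈W I₂∈W hyp (⊩-mono A (∧E₂ hyp) s₁) (⊩-mono A (∧E₂ hyp) s₂))
      (⊩-glue B J₁∈W J₂∈W hyp (⊩-mono B (∧E₂ hyp) t₁) (⊩-mono B (∧E₂ hyp) t₂))
  ⊩-glue {X = X} {Y} (A ⇒ B) X∈W Y∈W cover (d , f) (e , g) =
    ∨-cases cover d e ,
    λ v v∈W v≤w a → ⊩-glue B X∈W Y∈W (⊢₁-trans v≤w cover)
      (f (v ∧ X) (∧-closed v∈W X∈W) (∧-monoˡ v≤w) (⊩-mono A (∧E₁ hyp) a))
      (g (v ∧ Y) (∧-closed v∈W Y∈W) (∧-monoˡ v≤w) (⊩-mono A (∧E₁ hyp) a))

  infix 3 _⊩*_
  _⊩*_ : Formula → List Formula → Set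
  w ⊩* Γ = All (w ⊩_) Γ

  ⊩*-mono : ∀ {w v Γ} → v ⊢₁ w → w ⊩* Γ → v ⊩* Γ
  ⊩*-mono v≤w = All.map λ {A} → ⊩-mono A v≤w

  reify* : ∀ {w Γ} → w ⊩* Γ → Substitution Γ (w ∷ [])
  reify* ρ {A} i = reify A (All.lookup ρ i)

  soundness : ∀ {w Γ A} → W w → w ⊩* Γ → Γ ⊢ A → w ⊩ A
  soundness _ ρ (ax i) = All.lookup ρ i
  soundness _ ρ ⊤I = tt
  soundness {A = A} w∈W ρ (⊥E d) = ⊩-⊥E A (soundness w∈W ρ d)
  soundness w∈W ρ (∧I d e) = soundness w∈W ρ d , soundness w∈W ρ e
  soundness w∈W ρ (∧E₁ d) = proj₁ (soundness w∈W ρ d)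
  soundness w∈W ρ (∧E₂ d) = proj₂ (soundness w∈W ρ d)
  soundness {w} w∈W ρ (∨I₁ {ψ = B} d) =
    split w ⊥′ w∈W ⊥-closed (∨I₁ hyp) (soundness w∈W ρ d) (⊩-⊥E B hyp)
  soundness {w} w∈W ρ (∨I₂ {φ = A} d) =
    split ⊥′ w ⊥-closed w∈W (∨I₂ hyp) (⊩-⊥E A hyp) (soundness w∈W ρ d)
  soundness {A = C} w∈W ρ (∨E {φ = A} {ψ = B} d e f) =
    let split I J I∈W J∈W cover s t = soundness w∈W ρ d
    in ⊩-glue C I∈W J∈W cover
         (soundness (∧-closed w∈W I∈W) (⊩-mono A (∧E₂ hyp) s ∷ ⊩*-mono (∧E₁ hyp) ρ) e)
         (soundness (∧-closed w∈W J∈W) (⊩-mono B (∧E₂ hyp) t ∷ ⊩*-mono (∧E₁ hyp) ρ) f)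
  soundness w∈W ρ (⇒I d) =
    substitute (reify* ρ) (⇒I d) , λ v v∈W v≤w a → soundness v∈W (a ∷ ⊩*-mono v≤w ρ) d
  soundness {w} w∈W ρ (⇒E d e) = proj₂ (soundness w∈W ρ d) w w∈W hyp (soundness w∈W ρ e)

  disjunctive-interpolation : ∀ φ ψ θ → W φ → IPC (φ ⇒ ψ ∨ θ) →
    Σ Formula λ I → Σ Formula λ J →
      W I × W J × IPC (φ ⇒ I ∨ J) × IPC (I ⇒ ψ) × IPC (J ⇒ θ)
  disjunctive-interpolation φ ψ θ φ∈W ⊢φ⇒ψ∨θ =
    let split I J I∈W J∈W cover s t =
          proj₂ (soundness φ∈W [] ⊢φ⇒ψ∨θ) φ φ∈W hyp (reflect φ φ∈W hyp)
    in I , J , I∈W , J∈W , ⇒I cover , ⇒I (reify ψ s) , ⇒I (reify θ t)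

open InterpolantClass
open Forcing using (disjunctive-interpolation)

atoms⊆-class : ∀ φ → InterpolantClass (_⊆V φ)
atoms⊆-class φ .⊥-closed ()
atoms⊆-class φ .∧-closed X⊆φ _ (∧ˡ p) = X⊆φ p
atoms⊆-class φ .∧-closed _ Y⊆φ (∧ʳ p) = Y⊆φ p
atoms⊆-class φ .∨-closed X⊆φ _ (∨ˡ p) = X⊆φ p
atoms⊆-class φ .∨-closed _ Y⊆φ (∨ʳ p) = Y⊆φ p
atoms⊆-class φ .∧-inversion X∧Y⊆φ = (λ p → X∧Y⊆φ (∧ˡ p)) , (λ p → X∧Y⊆φ (∧ʳ p))
atoms⊆-class φ .∨-inversion X∨Y⊆φ = (λ p → X∨Y⊆φ (∨ˡ p)) , (λ p → X∨Y⊆φ (∨ʳ p))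
atoms⊆-class φ .⇒-inversion X⇒Y⊆φ p = X⇒Y⊆φ (⇒ʳ p)

monotone-class : InterpolantClass Monotone
monotone-class .⊥-closed = ⊥′
monotone-class .∧-closed = _∧_
monotone-class .∨-closed = _∨_
monotone-class .∧-inversion (m ∧ n) = m , n
monotone-class .∨-inversion (m ∨ n) = m , n
monotone-class .⇒-inversion ()

∩-class : ∀ {V W} → InterpolantClass V → InterpolantClass W → InterpolantClass (V ∩ W)
∩-class 𝒱 𝒲 .⊥-closed = 𝒱 .⊥-closed , 𝒲 .⊥-closed
∩-class 𝒱 𝒲 .∧-closed (v₁ , w₁) (v₂ , w₂) = 𝒱 .∧-closed v₁ v₂ , 𝒲 .∧-closed w₁ w₂
∩-class 𝒱 𝒲 .∨-closed (v₁ , w₁) (v₂ , w₂) = 𝒱 .∨-closed v₁ v₂ , 𝒲 .∨-closed w₁ w₂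
∩-class 𝒱 𝒲 .∧-inversion (v , w) =
  let v₁ , v₂ = 𝒱 .∧-inversion v ; w₁ , w₂ = 𝒲 .∧-inversion w in (v₁ , w₁) , (v₂ , w₂)
∩-class 𝒱 𝒲 .∨-inversion (v , w) =
  let v₁ , v₂ = 𝒱 .∨-inversion v ; w₁ , w₂ = 𝒲 .∨-inversion w in (v₁ , w₁) , (v₂ , w₂)
∩-class 𝒱 𝒲 .⇒-inversion (v , w) = 𝒱 .⇒-inversion v , 𝒲 .⇒-inversion w

theorem5p8 : HasPDIP × HasmPDIP
theorem5p8 = pdip , mpdip
  where
  pdip : HasPDIP
  pdip φ ψ θ = disjunctive-interpolation (atoms⊆-class φ) φ ψ θ id

  mpdip : HasmPDIP
  mpdip φ ψ θ φ-monotone ⊢φ⇒ψ∨θ =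
    let I , J , (I-monotone , I⊆φ) , (J-monotone , J⊆φ) , interpolates =
          disjunctive-interpolation (∩-class monotone-class (atoms⊆-class φ))
            φ ψ θ (φ-monotone , id) ⊢φ⇒ψ∨θ
    in I , J , I-monotone , J-monotone , I⊆φ , J⊆φ , interpolates
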